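{- For any integers $k\geq 0$ and $n\geq l\geq k+1$, the number $op_{n,k,=l}^{k+1}$ of ordered preference sets $(a_1,\dots,a_n)$ of length $n$ with exactly $k$ flaws, leading term $a_1=k+1$ and $\max_i a_i=l$ equals $\frac{n-l+k+1}{n+l-k-1}\binom{n+l-k-1}{l-k-1}$.
   Context: Parking model: $n$ parking spaces numbered $1,\dots,n$ from left to right; a preference set of length $n$ is a sequence $(a_1,\dots,a_n)$ with $a_i\in[n]$. Cars arrive in order; car $i$ goes to space $a_i$, and if it is occupied, moves to the first unoccupied space to the right; if there is none, the car cannot park. The number of flaws is the number of cars that cannot park. A preference set is ordered if $a_1\leq\cdots\leq a_n$; its leading term is $a_1$. -}

module Defs where

open import Data.Nat using (ℕ; zero; suc; _+_; _∸_; _≤_; _<ᵇ_; _≡ᵇ_; _≤ᵇ_)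
open import Data.Bool using (Bool; true; false; _∧_; if_then_else_; not)
open import Data.List using (List; []; _∷_; length; filter; map; concatMap; upTo; foldr; head)
open import Data.Maybe using (Maybe; just; nothing)
open import Relation.Nullary.Decidable using (yes; no)
open import Relation.Binary.PropositionalEquality using (_≡_)

-- Occupancy of spaces 1..n is a list of Booleans (index 0 ↦ space 1).
-- occupied o s : is space s (1-based) occupied?
occupied : List Bool → ℕ → Bool
occupied []       _             = false
occupied (b ∷ o)  zero          = false   -- space 0 does not exist
occupied (b ∷ o)  (suc zero)    = b
occupied (b ∷ o)  (suc (suc s)) = occupied o (suc s)

-- Returns just the new occupancy if it parks, nothing otherwise.
-- (spaces are 1-based; position a corresponds to list index a-1)
parkFrom : List Bool → ℕ → Maybe (List Bool)
parkFrom []            _       = nothing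
parkFrom (false ∷ o)   zero    = just (true ∷ o)
parkFrom (true ∷ o)    zero    = Data.Maybe.map (true ∷_) (parkFrom o zero)
parkFrom (b ∷ o)       (suc i) = Data.Maybe.map (b ∷_) (parkFrom o i)

park : List Bool → ℕ → Maybe (List Bool)
park o a = parkFrom o (a ∸ 1)

emptyLot : ℕ → List Bool
emptyLot zero    = []
emptyLot (suc n) = false ∷ emptyLot n

flawsFrom : List Bool → List ℕ → ℕ
flawsFrom o []       = 0
flawsFrom o (a ∷ as) with park o a
... | just o' = flawsFrom o' as
... | nothing = suc (flawsFrom o as)

flaws : ℕ → List ℕ → ℕ
flaws n as = flawsFrom (emptyLot n) as

allSeqs : ℕ → ℕ → List (List ℕ)
allSeqs n zero    = [] ∷ []
allSeqs n (suc m) = concatMap (λ a → map (a ∷_) (allSeqs n m)) (map suc (upTo n))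

prefSets : ℕ → List (List ℕ)
prefSets n = allSeqs n n

isOrdered : List ℕ → Bool
isOrdered []           = true
isOrdered (a ∷ [])     = true
isOrdered (a ∷ b ∷ as) = (a ≤ᵇ b) ∧ isOrdered (b ∷ as)

leadingIs : ℕ → List ℕ → Bool
leadingIs c []      = false
leadingIs c (a ∷ _) = a ≡ᵇ c

maxList : List ℕ → ℕ
maxList = foldr Data.Nat._⊔_ 0

selected : ℕ → ℕ → ℕ → List ℕ → Bool
selected n k l as =
  isOrdered as ∧ (flaws n as ≡ᵇ k) ∧ leadingIs (suc k) as ∧ (maxList as ≡ᵇ l)

op : ℕ → ℕ → ℕ → ℕ
op n k l = length (filter (λ as → Data.Bool._≟_ (selected n k l as) true) (prefSets n))

module Submission where

-- An ordered preference sequence never looks back: every car prefers a space at least as far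
-- right as all earlier cars, so the lot only matters from the previous preference on, where it
-- consists of a block of occupied spaces followed by free ones.  With leading term k + 1 the
-- n − k spaces k + 1, …, n serve n cars, so exactly k flaws means that every one of these spaces
-- gets filled, i.e. no car prefers a space beyond the first free one: a ballot condition on the
-- monotone path a₁ ≤ a₂ ≤ … ≤ l.
--
-- Counting continuations by the preference of the next car gives Pascal's recurrence, solved by
-- the reflection principle: with m cars to come, current preference at distance e below l and
-- the last occupied space h − 1 beyond it, there are C(m−1+e, e) − C(m−1+e, e−h−1) of them.
-- Initially m = n − 1, e = l − k − 1 and h = 1, and the absorption identity
-- (j+1)·C(N+1, j+1) = (N+1)·C(N, j) turns C(N, e) − C(N, e−2) into the stated quotient.

open import Algebra.Properties.CommutativeSemigroup using (interchange)
open import Data.Bool using (Bool; true; false; _∧_; not; if_then_else_; T)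
open import Data.Bool.Properties using (T-∧; T-≡; ∧-zeroʳ)
open import Data.Empty using (⊥-elim)
open import Data.List using (List; []; _∷_; length; filter; map; concatMap; upTo; applyUpTo; _++_; replicate; drop)
open import Data.List.Properties using (map-upTo; map-cong; length-++; length-replicate; length-drop)
open import Data.Maybe using (Maybe; just; nothing)
import Data.Maybe.Properties as Maybe
open import Data.Nat using (ℕ; zero; suc; _+_; _*_; _∸_; _≤_; _<_; _≡ᵇ_; _≤ᵇ_; _⊔_; z≤n; s≤s)
open import Data.Nat.Combinatorics using (_C_; nCk+nC[k+1]≡[n+1]C[k+1]; k>n⇒nCk≡0; nC1≡n; nCn≡1)
open import Data.Nat.ListAction using (sum)
open import Data.Nat.Properties
open import Data.Nat.Tactic.RingSolver using (solve-∀)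
open import Data.Product using (_×_; _,_; proj₁; proj₂)
open import Function using (_∘_)
open import Function.Bundles using (Equivalence)
open import Relation.Binary.PropositionalEquality
open import Relation.Nullary using (¬_)

open import Defs

count : {A : Set} → (A → Bool) → List A → ℕ
count P []       = 0
count P (x ∷ xs) = if P x then suc (count P xs) else count P xs

length-filter≡count : {A : Set} (P : A → Bool) (xs : List A) →
  length (filter (λ x → Data.Bool._≟_ (P x) true) xs) ≡ count P xs
length-filter≡count P [] = refl
length-filter≡count P (x ∷ xs) with P x
... | true  = cong suc (length-filter≡count P xs)
... | false = length-filter≡count P xs

count-++ : {A : Set} (P : A → Bool) (xs ys : List A) → count P (xs ++ ys) ≡ count P xs + count P ys
count-++ P [] ys = refl
count-++ P (x ∷ xs) ys with P x
... | true  = cong suc (count-++ P xs ys)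
... | false = count-++ P xs ys

count-concatMap : {A B : Set} (P : B → Bool) (F : A → List B) (xs : List A) →
  count P (concatMap F xs) ≡ sum (map (count P ∘ F) xs)
count-concatMap P F [] = refl
count-concatMap P F (x ∷ xs) =
  trans (count-++ P (F x) (concatMap F xs)) (cong (count P (F x) +_) (count-concatMap P F xs))

count-map : {A B : Set} (P : B → Bool) (g : A → B) (xs : List A) → count P (map g xs) ≡ count (P ∘ g) xs
count-map P g [] = refl
count-map P g (x ∷ xs) with P (g x)
... | true  = cong suc (count-map P g xs)
... | false = count-map P g xs

count-cong : {A : Set} {P Q : A → Bool} → (∀ x → P x ≡ Q x) → (xs : List A) → count P xs ≡ count Q xs
count-cong P≗Q [] = refl
count-cong {Q = Q} P≗Q (x ∷ xs) rewrite P≗Q x with Q x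
... | true  = cong suc (count-cong P≗Q xs)
... | false = count-cong P≗Q xs

count-false : {A : Set} (xs : List A) → count (λ _ → false) xs ≡ 0
count-false []       = refl
count-false (x ∷ xs) = count-false xs

count≤length : {A : Set} (P : A → Bool) (xs : List A) → count P xs ≤ length xs
count≤length P [] = z≤n
count≤length P (x ∷ xs) with P x
... | true  = s≤s (count≤length P xs)
... | false = m≤n⇒m≤1+n (count≤length P xs)

if-≡ᵇ-yes : {A : Set} {a b : ℕ} {x y : A} → a ≡ b → (if a ≡ᵇ b then x else y) ≡ x
if-≡ᵇ-yes {a = a} {b} a≡b with a ≡ᵇ b | ≡⇒≡ᵇ a b a≡b
... | true | _ = refl

if-≡ᵇ-no : {A : Set} {a b : ℕ} {x y : A} → a ≢ b → (if a ≡ᵇ b then x else y) ≡ y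
if-≡ᵇ-no {a = a} {b} a≢b with a ≡ᵇ b | ≡ᵇ⇒≡ a b
... | true  | eq = ⊥-elim (a≢b (eq _))
... | false | _  = refl

sumRange : (ℕ → ℕ) → ℕ → ℕ → ℕ
sumRange g lo zero    = 0
sumRange g lo (suc c) = g lo + sumRange g (suc lo) c

sum-map-applyUpTo : (g f : ℕ → ℕ) (lo c : ℕ) → (∀ i → f i ≡ lo + i) →
  sum (map g (applyUpTo f c)) ≡ sumRange g lo c
sum-map-applyUpTo g f lo zero f≗lo+ = refl
sum-map-applyUpTo g f lo (suc c) f≗lo+ =
  cong₂ _+_ (cong g (trans (f≗lo+ 0) (+-identityʳ lo)))
            (sum-map-applyUpTo g (f ∘ suc) (suc lo) c (λ i → trans (f≗lo+ (suc i)) (+-suc lo i)))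

sum-map-suc-upTo : (g : ℕ → ℕ) (n : ℕ) → sum (map g (map suc (upTo n))) ≡ sumRange g 1 n
sum-map-suc-upTo g n = trans (cong (sum ∘ map g) (map-upTo suc n)) (sum-map-applyUpTo g suc 1 n (λ _ → refl))

sumRange-++ : (g : ℕ → ℕ) (lo i j : ℕ) → sumRange g lo (i + j) ≡ sumRange g lo i + sumRange g (lo + i) j
sumRange-++ g lo zero j = cong (λ x → sumRange g x j) (sym (+-identityʳ lo))
sumRange-++ g lo (suc i) j =
  trans (cong (g lo +_) (trans (sumRange-++ g (suc lo) i j) (cong (λ x → sumRange g (suc lo) i + sumRange g x j) (sym (+-suc lo i)))))
        (sym (+-assoc (g lo) _ _))

sumRange-cong : {g h : ℕ → ℕ} (lo c : ℕ) → (∀ i → i < c → g (lo + i) ≡ h (lo + i)) → sumRange g lo c ≡ sumRange h lo c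
sumRange-cong lo zero g≗h = refl
sumRange-cong {g} {h} lo (suc c) g≗h =
  cong₂ _+_ (subst (λ x → g x ≡ h x) (+-identityʳ lo) (g≗h 0 (s≤s z≤n)))
            (sumRange-cong (suc lo) c (λ i i<c → subst (λ x → g x ≡ h x) (+-suc lo i) (g≗h (suc i) (s≤s i<c))))

sumRange-≗0 : {g : ℕ → ℕ} (lo c : ℕ) → (∀ i → i < c → g (lo + i) ≡ 0) → sumRange g lo c ≡ 0
sumRange-≗0 {g} lo zero g≗0 = refl
sumRange-≗0 {g} lo (suc c) g≗0 =
  cong₂ _+_ (subst (λ x → g x ≡ 0) (+-identityʳ lo) (g≗0 0 (s≤s z≤n)))
            (sumRange-≗0 (suc lo) c (λ i i<c → subst (λ x → g x ≡ 0) (+-suc lo i) (g≗0 (suc i) (s≤s i<c))))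

sumRange-drop-zeros : {g : ℕ → ℕ} {a n : ℕ} → a ≤ n → (∀ i → i < a → g (suc i) ≡ 0) →
  sumRange g 1 n ≡ sumRange g (suc a) (n ∸ a)
sumRange-drop-zeros {g} {a} {n} a≤n g≗0 = begin
  sumRange g 1 n                                ≡⟨ cong (sumRange g 1) (sym (m+[n∸m]≡n a≤n)) ⟩
  sumRange g 1 (a + (n ∸ a))                    ≡⟨ sumRange-++ g 1 a (n ∸ a) ⟩
  sumRange g 1 a + sumRange g (suc a) (n ∸ a)   ≡⟨ cong (_+ sumRange g (suc a) (n ∸ a)) (sumRange-≗0 1 a g≗0) ⟩
  sumRange g (suc a) (n ∸ a)                    ∎
  where open ≡-Reasoning

sumRange-only : (g : ℕ → ℕ) {c n : ℕ} → c < n → (∀ b → b ≢ suc c → g b ≡ 0) → sumRange g 1 n ≡ g (suc c)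
sumRange-only g {c} {suc n} (s≤s c≤n) g≗0 = begin
  sumRange g 1 (suc n)                           ≡⟨ sumRange-drop-zeros (m≤n⇒m≤1+n c≤n) (λ i i<c → g≗0 (suc i) (<⇒≢ (s≤s i<c))) ⟩
  sumRange g (suc c) (suc n ∸ c)                 ≡⟨ cong (sumRange g (suc c)) (+-∸-assoc 1 c≤n) ⟩
  g (suc c) + sumRange g (suc (suc c)) (n ∸ c)   ≡⟨ cong (g (suc c) +_) (sumRange-≗0 (suc (suc c)) (n ∸ c) (λ i _ → g≗0 _ (>⇒≢ (s≤s (s≤s (m≤m+n c i)))))) ⟩
  g (suc c) + 0                                  ≡⟨ +-identityʳ _ ⟩
  g (suc c)                                      ∎
  where open ≡-Reasoning

-- C∸ N e j = N C (e ∸ j), except that it vanishes for j > e, where truncated subtraction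
-- would give N C 0.
C∸ : ℕ → ℕ → ℕ → ℕ
C∸ N e       zero    = N C e
C∸ N zero    (suc j) = 0
C∸ N (suc e) (suc j) = C∸ N e j

C∸-vanish : ∀ N {e j} → e < j → C∸ N e j ≡ 0
C∸-vanish N {zero}  {suc j} _         = refl
C∸-vanish N {suc e} {suc j} (s≤s e<j) = C∸-vanish N e<j

C∸-pascal : ∀ N e j → C∸ (suc N) e j ≡ C∸ N e (suc j) + C∸ N e j
C∸-pascal N zero    zero    = refl
C∸-pascal N (suc e) zero    = sym (nCk+nC[k+1]≡[n+1]C[k+1] N e)
C∸-pascal N zero    (suc j) = refl
C∸-pascal N (suc e) (suc j) = C∸-pascal N e j

absorption : ∀ N k → suc k * (suc N C suc k) ≡ suc N * (N C k)
absorption zero zero = refl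
absorption zero (suc k) rewrite k>n⇒nCk≡0 {1} {suc (suc k)} (s≤s (s≤s z≤n)) | k>n⇒nCk≡0 {0} {suc k} (s≤s z≤n) = *-zeroʳ (suc (suc k))
absorption (suc N) zero rewrite nC1≡n (suc (suc N)) = trans (+-identityʳ _) (sym (*-identityʳ _))
absorption (suc N) (suc k) = begin
  suc (suc k) * (suc (suc N) C suc (suc k))
    ≡⟨ cong (suc (suc k) *_) (sym (nCk+nC[k+1]≡[n+1]C[k+1] (suc N) (suc k))) ⟩
  suc (suc k) * (suc N C suc k + suc N C suc (suc k))
    ≡⟨ split (suc N C suc k) (suc N C suc (suc k)) ⟩
  suc k * (suc N C suc k) + suc (suc k) * (suc N C suc (suc k)) + suc N C suc k
    ≡⟨ cong (_+ suc N C suc k) (cong₂ _+_ (absorption N k) (absorption N (suc k))) ⟩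
  suc N * (N C k) + suc N * (N C suc k) + suc N C suc k
    ≡⟨ cong (_+ suc N C suc k) (sym (*-distribˡ-+ (suc N) (N C k) (N C suc k))) ⟩
  suc N * (N C k + N C suc k) + suc N C suc k
    ≡⟨ cong (λ x → suc N * x + suc N C suc k) (nCk+nC[k+1]≡[n+1]C[k+1] N k) ⟩
  suc N * (suc N C suc k) + suc N C suc k
    ≡⟨ +-comm (suc N * (suc N C suc k)) _ ⟩
  suc (suc N) * (suc N C suc k)
    ∎
  where
  open ≡-Reasoning
  split : ∀ x y → suc (suc k) * (x + y) ≡ suc k * x + suc (suc k) * y + x
  split = solve-∀

-- With m cars to come, current preference a, maximum a + e and last occupied space a + h − 1:
-- the number of monotone continuations ending at a + e, and (by reflection) the number of those
-- in which some car prefers a space beyond the first free one.  For m = 0 only the empty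
-- continuation exists.
allPaths : ℕ → ℕ → ℕ
allPaths zero    zero    = 1
allPaths zero    (suc e) = 0
allPaths (suc m) e       = (m + e) C e

crossingPaths : ℕ → ℕ → ℕ → ℕ
crossingPaths zero    h e = 0
crossingPaths (suc m) h e = C∸ (m + e) e (suc h)

allPaths-zero : ∀ m → allPaths m 0 ≡ 1
allPaths-zero zero    = refl
allPaths-zero (suc m) = refl

crossingPaths-vanish : ∀ m {h e} → e ≤ h → crossingPaths m h e ≡ 0
crossingPaths-vanish zero    e≤h = refl
crossingPaths-vanish (suc m) e≤h = C∸-vanish _ (s≤s e≤h)

paths-step-frontier : ∀ m e {X} → (m ≡ 0 → e ≡ 0) → X + crossingPaths m 1 e ≡ allPaths m e → X + crossingPaths (suc m) 0 e ≡ allPaths (suc m) e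
paths-step-frontier zero e m≡0⇒e≡0 hyp with m≡0⇒e≡0 refl
... | refl = hyp
paths-step-frontier (suc m) e {X} _ hyp = begin
  X + C∸ (suc N) e 1         ≡⟨ cong (X +_) (C∸-pascal N e 1) ⟩
  X + (C∸ N e 2 + C∸ N e 1)  ≡⟨ +-assoc X _ _ ⟨
  X + C∸ N e 2 + C∸ N e 1    ≡⟨ cong (_+ C∸ N e 1) hyp ⟩
  N C e + C∸ N e 1           ≡⟨ +-comm (N C e) _ ⟩
  C∸ N e 1 + C∸ N e 0        ≡⟨ C∸-pascal N e 0 ⟨
  suc N C e                  ∎
  where
  open ≡-Reasoning
  N = m + e

paths-step : ∀ m e h {X Y} → (m ≡ 0 → e ≤ h) →
  X + crossingPaths m (suc (suc h)) (suc e) ≡ allPaths m (suc e) → Y + crossingPaths (suc m) h e ≡ allPaths (suc m) e →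
  X + Y + crossingPaths (suc m) (suc h) (suc e) ≡ allPaths (suc m) (suc e)
paths-step zero e h {X} {Y} m≡0⇒e≤h hypX hypY = begin
  X + Y + C∸ (suc e) e (suc h)  ≡⟨ cong₂ _+_ (cong (_+ Y) (m+n≡0⇒m≡0 X hypX)) (C∸-vanish (suc e) (s≤s e≤h)) ⟩
  Y + 0                         ≡⟨ cong (Y +_) (C∸-vanish e (s≤s e≤h)) ⟨
  Y + C∸ e e (suc h)            ≡⟨ hypY ⟩
  e C e                         ≡⟨ trans (nCn≡1 e) (sym (nCn≡1 (suc e))) ⟩
  suc e C suc e                 ∎
  where
  open ≡-Reasoning
  e≤h = m≡0⇒e≤h refl
paths-step (suc m) e h {X} {Y} _ hypX hypY = begin
  X + Y + C∸ (suc N) e (suc h)                   ≡⟨ cong (X + Y +_) (C∸-pascal N e (suc h)) ⟩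
  X + Y + (C∸ N e (suc (suc h)) + C∸ N e (suc h)) ≡⟨ interchange +-commutativeSemigroup X Y _ _ ⟩
  X + C∸ N e (suc (suc h)) + (Y + C∸ N e (suc h)) ≡⟨ cong₂ _+_ hypX hypY′ ⟩
  N C suc e + N C e                              ≡⟨ +-comm (N C suc e) _ ⟩
  N C e + N C suc e                              ≡⟨ nCk+nC[k+1]≡[n+1]C[k+1] N e ⟩
  suc N C suc e                                  ∎
  where
  open ≡-Reasoning
  N = m + suc e
  hypY′ : Y + C∸ N e (suc h) ≡ N C e
  hypY′ = subst (λ M → Y + C∸ M e (suc h) ≡ M C e) (sym (+-suc m e)) hypY

ballot-formula : ∀ j e {X} → X + crossingPaths (e + j) 1 e ≡ allPaths (e + j) e → X * (suc (e + j) + e) ≡ suc j * ((suc (e + j) + e) C e)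
ballot-formula j zero {X} hyp = subst (λ x → x * suc (j + 0) ≡ suc j * 1) (sym X≡1) (unit j)
  where
  X≡1 : X ≡ 1
  X≡1 = trans (sym (+-identityʳ X)) (trans (cong (X +_) (sym (crossingPaths-vanish j z≤n))) (trans hyp (allPaths-zero j)))
  unit : ∀ j → 1 * suc (j + 0) ≡ suc j * 1
  unit = solve-∀
ballot-formula j (suc zero) {X} hyp
  rewrite +-identityʳ X | nC1≡n (j + 1) | nC1≡n (suc (suc j) + 1) | hyp | +-comm j 1 = refl
ballot-formula j (suc (suc e)) {X} hyp = +-cancelʳ-≡ (c * suc (suc N)) _ _ (begin
  X * suc (suc N) + c * suc (suc N)     ≡⟨ *-distribʳ-+ (suc (suc N)) X c ⟨
  (X + c) * suc (suc N)                 ≡⟨ cong (_* suc (suc N)) hyp ⟩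
  a * suc (suc N)                       ≡⟨ +-cancelʳ-≡ _ _ _ (trans (expand e j a b c) (cong (suc j * (c + b + (b + a)) + c * suc (suc N) +_) absorbed)) ⟩
  suc j * (c + b + (b + a)) + c * suc (suc N)
    ≡⟨ cong (λ x → suc j * x + c * suc (suc N)) pascal² ⟩
  suc j * (suc (suc N) C suc (suc e)) + c * suc (suc N) ∎)
  where
  open ≡-Reasoning
  N = suc (e + j) + suc (suc e)
  a = N C suc (suc e)
  b = N C suc e
  c = N C e
  pascal² : c + b + (b + a) ≡ suc (suc N) C suc (suc e)
  pascal² = trans (cong₂ _+_ (nCk+nC[k+1]≡[n+1]C[k+1] N e) (nCk+nC[k+1]≡[n+1]C[k+1] N (suc e)))
                  (nCk+nC[k+1]≡[n+1]C[k+1] (suc N) (suc e))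
  absorbed : 2 * (suc (suc e) * (b + a)) + 2 * (suc e * (c + b)) ≡ 2 * (suc N * b) + 2 * (suc N * c)
  absorbed = cong₂ (λ x y → 2 * x + 2 * y)
    (trans (cong (suc (suc e) *_) (nCk+nC[k+1]≡[n+1]C[k+1] N (suc e))) (absorption N (suc e)))
    (trans (cong (suc e *_) (nCk+nC[k+1]≡[n+1]C[k+1] N e)) (absorption N e))
  -- By absorbed the last summands of the two sides agree.
  expand : ∀ e j a b c →
    a * suc (suc (suc (e + j) + suc (suc e)))
      + (2 * (suc (suc (e + j) + suc (suc e)) * b) + 2 * (suc (suc (e + j) + suc (suc e)) * c))
    ≡ suc j * (c + b + (b + a)) + c * suc (suc (suc (e + j) + suc (suc e)))
      + (2 * (suc (suc e) * (b + a)) + 2 * (suc e * (c + b)))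
  expand = solve-∀

count-allSeqs-suc : (n m : ℕ) (P : List ℕ → Bool) →
  count P (allSeqs n (suc m)) ≡ sumRange (λ b → count (P ∘ (b ∷_)) (allSeqs n m)) 1 n
count-allSeqs-suc n m P = begin
  count P (concatMap (λ b → map (b ∷_) (allSeqs n m)) (map suc (upTo n)))
    ≡⟨ count-concatMap P _ (map suc (upTo n)) ⟩
  sum (map (λ b → count P (map (b ∷_) (allSeqs n m))) (map suc (upTo n)))
    ≡⟨ cong sum (map-cong (λ b → count-map P (b ∷_) (allSeqs n m)) (map suc (upTo n))) ⟩
  sum (map (λ b → count (P ∘ (b ∷_)) (allSeqs n m)) (map suc (upTo n)))
    ≡⟨ sum-map-suc-upTo _ n ⟩
  sumRange (λ b → count (P ∘ (b ∷_)) (allSeqs n m)) 1 n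
    ∎
  where open ≡-Reasoning

count-allSeqs-none : (n m : ℕ) (P : List ℕ → Bool) → (∀ cs → length cs ≡ m → ¬ T (P cs)) →
  count P (allSeqs n m) ≡ 0
count-allSeqs-none n zero P none with P [] | none [] refl
... | true  | ¬p = ⊥-elim (¬p _)
... | false | _  = refl
count-allSeqs-none n (suc m) P none =
  trans (count-allSeqs-suc n m P)
        (sumRange-≗0 1 n (λ b _ → count-allSeqs-none n m _ (λ cs len → none (_ ∷ cs) (cong suc len))))

parkFrom-cons-suc : ∀ b o i → parkFrom (b ∷ o) (suc i) ≡ Data.Maybe.map (b ∷_) (parkFrom o i)
parkFrom-cons-suc true  o i = refl
parkFrom-cons-suc false o i = refl

parkFrom-++ : ∀ xs ys i → parkFrom (xs ++ ys) (length xs + i) ≡ Data.Maybe.map (xs ++_) (parkFrom ys i)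
parkFrom-++ []       ys i = sym (Maybe.map-id (parkFrom ys i))
parkFrom-++ (x ∷ xs) ys i
  rewrite parkFrom-cons-suc x (xs ++ ys) (length xs + i) | parkFrom-++ xs ys i = sym (Maybe.map-∘ (parkFrom ys i))

parkFrom-block : ∀ t zs i → i ≤ t → parkFrom (replicate t true ++ false ∷ zs) i ≡ just (replicate (suc t) true ++ zs)
parkFrom-block zero    zs zero    _         = refl
parkFrom-block (suc t) zs zero    _         rewrite parkFrom-block t zs zero z≤n = refl
parkFrom-block (suc t) zs (suc i) (s≤s i≤t) rewrite parkFrom-block t zs i i≤t = refl

parkFrom-full : ∀ t i → i ≤ t → parkFrom (replicate t true ++ []) i ≡ nothing
parkFrom-full zero    zero    _         = refl
parkFrom-full (suc t) zero    _         rewrite parkFrom-full t zero z≤n = refl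
parkFrom-full (suc t) (suc i) (s≤s i≤t) rewrite parkFrom-full t i i≤t = refl

-- Spaces beyond the prefix xs: t occupied, then r free.  The contents of xs never matter once
-- all later preferences exceed length xs.
lot : List Bool → ℕ → ℕ → List Bool
lot xs t r = xs ++ replicate t true ++ replicate r false

parkFrom-lot-suc : ∀ xs t r {j} → length xs ≤ j → j ≤ length xs + t →
  parkFrom (lot xs t (suc r)) j ≡ just (lot xs (suc t) r)
parkFrom-lot-suc xs t r xs≤j j≤ with m≤n⇒∃[o]m+o≡n xs≤j
... | i , refl rewrite parkFrom-++ xs (replicate t true ++ replicate (suc r) false) i
                     | parkFrom-block t (replicate r false) i (+-cancelˡ-≤ (length xs) i t j≤) = refl

parkFrom-lot-zero : ∀ xs t {j} → length xs ≤ j → j ≤ length xs + t → parkFrom (lot xs t zero) j ≡ nothing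
parkFrom-lot-zero xs t xs≤j j≤ with m≤n⇒∃[o]m+o≡n xs≤j
... | i , refl rewrite parkFrom-++ xs (replicate t true ++ []) i
                     | parkFrom-full t i (+-cancelˡ-≤ (length xs) i t j≤) = refl

length-lot : ∀ xs t r → length (lot xs t r) ≡ length xs + t + r
length-lot xs t r rewrite length-++ xs {replicate t true ++ replicate r false}
  | length-++ (replicate t true) {replicate r false} | length-replicate t {true} | length-replicate r {false} =
  sym (+-assoc (length xs) t r)

emptyLot≡replicate : ∀ n → emptyLot n ≡ replicate n false
emptyLot≡replicate zero    = refl
emptyLot≡replicate (suc n) = cong (false ∷_) (emptyLot≡replicate n)

parkFrom-emptyLot : ∀ {n k} → k < n → parkFrom (emptyLot n) k ≡ just (lot (replicate k false) 1 (n ∸ suc k))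
parkFrom-emptyLot {suc n} {zero}  _         = cong (just ∘ (true ∷_)) (emptyLot≡replicate n)
parkFrom-emptyLot {suc n} {suc k} (s≤s k<n) rewrite parkFrom-emptyLot k<n = refl

free : List Bool → ℕ
free = count not

free-drop≤ : ∀ i o → free (drop i o) ≤ length o ∸ i
free-drop≤ i o = ≤-trans (count≤length not (drop i o)) (≤-reflexive (length-drop i o))

parkFrom-fills : ∀ i j o {o'} → i ≤ j → parkFrom o j ≡ just o' → free (drop i o) ≡ suc (free (drop i o'))
parkFrom-fills zero zero (false ∷ o) _ refl = refl
parkFrom-fills zero zero (true ∷ o) _ eq with parkFrom o zero in e
parkFrom-fills zero zero (true ∷ o) _ refl | just o'' = parkFrom-fills zero zero o z≤n e
parkFrom-fills zero (suc j) (true ∷ o) _ eq with parkFrom o j in e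
parkFrom-fills zero (suc j) (true ∷ o) _ refl | just o'' = parkFrom-fills zero j o z≤n e
parkFrom-fills zero (suc j) (false ∷ o) _ eq with parkFrom o j in e
parkFrom-fills zero (suc j) (false ∷ o) _ refl | just o'' = cong suc (parkFrom-fills zero j o z≤n e)
parkFrom-fills (suc i) (suc j) (b ∷ o) (s≤s i≤j) eq rewrite parkFrom-cons-suc b o j with parkFrom o j in e
parkFrom-fills (suc i) (suc j) (b ∷ o) (s≤s i≤j) refl | just o'' = parkFrom-fills i j o i≤j e

flawsFrom-bound : ∀ {i} a o cs → i < a → T (isOrdered (a ∷ cs)) → length cs ≤ flawsFrom o cs + free (drop i o)
flawsFrom-bound a o [] i<a _ = z≤n
flawsFrom-bound {i} a o (b ∷ cs) i<a ord with Equivalence.to T-∧ ord | park o b in eq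
... | a≤ᵇb , ord′ | just o' = begin
  suc (length cs)                          ≤⟨ s≤s (flawsFrom-bound b o' cs i<b ord′) ⟩
  suc (flawsFrom o' cs + free (drop i o')) ≡⟨ +-suc _ _ ⟨
  flawsFrom o' cs + suc (free (drop i o')) ≡⟨ cong (flawsFrom o' cs +_) (parkFrom-fills i (b ∸ 1) o (∸-monoˡ-≤ 1 i<b) eq) ⟨
  flawsFrom o' cs + free (drop i o)        ∎
  where
  open ≤-Reasoning
  i<b = <-≤-trans i<a (≤ᵇ⇒≤ a b a≤ᵇb)
... | a≤ᵇb , ord′ | nothing = s≤s (flawsFrom-bound b o cs (<-≤-trans i<a (≤ᵇ⇒≤ a b a≤ᵇb)) ord′)

module Tails (n l : ℕ) where

  ValidTail : ℕ → List Bool → ℕ → List ℕ → Bool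
  ValidTail a o f cs = isOrdered (a ∷ cs) ∧ (flawsFrom o cs ≡ᵇ f) ∧ (maxList (a ∷ cs) ≡ᵇ l)

  ValidTailAfter : Maybe (List Bool) → ℕ → List Bool → ℕ → List ℕ → Bool
  ValidTailAfter (just o') b o f       cs = ValidTail b o' f cs
  ValidTailAfter nothing   b o zero    cs = false
  ValidTailAfter nothing   b o (suc f) cs = ValidTail b o f cs

  tails : ℕ → ℕ → List Bool → ℕ → ℕ
  tails m a o f = count (ValidTail a o f) (allSeqs n m)

  tailsAfter : ℕ → ℕ → List Bool → ℕ → ℕ
  tailsAfter m b o f = count (ValidTailAfter (park o b) b o f) (allSeqs n m)

  ValidTail-parts : ∀ {a o f cs} → T (ValidTail a o f cs) →
    T (isOrdered (a ∷ cs)) × flawsFrom o cs ≡ f × maxList (a ∷ cs) ≡ l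
  ValidTail-parts {a} {o} {f} {cs} valid
    with ordered , rest ← Equivalence.to (T-∧ {isOrdered (a ∷ cs)}) valid
    with flaws , max ← Equivalence.to (T-∧ {flawsFrom o cs ≡ᵇ f}) rest
    = ordered , ≡ᵇ⇒≡ _ f flaws , ≡ᵇ⇒≡ _ l max

  ValidTail-cons-< : ∀ {a b} o f cs → b < a → ValidTail a o f (b ∷ cs) ≡ false
  ValidTail-cons-< {a} {b} o f cs b<a with a ≤ᵇ b | ≤ᵇ⇒≤ a b
  ... | true  | a≤b = ⊥-elim (<⇒≱ b<a (a≤b _))
  ... | false | _   = refl

  ValidTail-cons-≥ : ∀ {a b} o f cs → a ≤ b → ValidTail a o f (b ∷ cs) ≡ ValidTailAfter (park o b) b o f cs
  ValidTail-cons-≥ {a} {b} o f cs a≤b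
    rewrite Equivalence.to T-≡ (≤⇒≤ᵇ a≤b) | m≤n⇒m⊔n≡n (m≤n⇒m≤n⊔o (maxList cs) a≤b) with park o b
  ... | just o' = refl
  ... | nothing = unparked f
    where
    unparked : ∀ f → isOrdered (b ∷ cs) ∧ (suc (flawsFrom o cs) ≡ᵇ f) ∧ (b ⊔ maxList cs ≡ᵇ l)
                     ≡ ValidTailAfter nothing b o f cs
    unparked zero    = ∧-zeroʳ (isOrdered (b ∷ cs))
    unparked (suc f) = refl

  tails-zero : ∀ {a} o → tails 0 a o 0 ≡ (if a ≡ᵇ l then 1 else 0)
  tails-zero {a} o rewrite ⊔-identityʳ a = refl

  tails-suc : ∀ m {a} o f → a ≤ n → tails (suc m) (suc a) o f ≡ sumRange (λ b → tailsAfter m b o f) (suc a) (n ∸ a)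
  tails-suc m {a} o f a≤n = begin
    tails (suc m) (suc a) o f
      ≡⟨ count-allSeqs-suc n m _ ⟩
    sumRange (λ b → count (ValidTail (suc a) o f ∘ (b ∷_)) (allSeqs n m)) 1 n
      ≡⟨ sumRange-drop-zeros a≤n (λ i i<a → trans (count-cong (λ cs → ValidTail-cons-< o f cs (s≤s i<a)) (allSeqs n m)) (count-false (allSeqs n m))) ⟩
    sumRange (λ b → count (ValidTail (suc a) o f ∘ (b ∷_)) (allSeqs n m)) (suc a) (n ∸ a)
      ≡⟨ sumRange-cong (suc a) (n ∸ a) (λ i _ → count-cong (λ cs → ValidTail-cons-≥ o f cs (s≤s (m≤m+n a i))) (allSeqs n m)) ⟩
    sumRange (λ b → tailsAfter m b o f) (suc a) (n ∸ a)
      ∎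
    where open ≡-Reasoning

  tails-peel : ∀ m {a} o f → 0 < a → a ≤ n → tails (suc m) a o f ≡ tailsAfter m a o f + tails (suc m) (suc a) o f
  tails-peel m {suc a} o f _ a<n =
    trans (tails-suc m o f (<⇒≤ a<n))
          (trans (cong (sumRange (λ b → tailsAfter m b o f) (suc a)) (+-∸-assoc 1 a<n))
                 (cong (tailsAfter m (suc a) o f +_) (sym (tails-suc m o f a<n))))

  tails-vanish-max : ∀ m {a} o f → l < a → tails m a o f ≡ 0
  tails-vanish-max m {a} o f l<a = count-allSeqs-none n m _ (λ cs _ valid →
    <⇒≱ l<a (subst (a ≤_) (proj₂ (proj₂ (ValidTail-parts {a} {o} {f} {cs} valid))) (m≤m⊔n a (maxList cs))))

  tails-vanish-flaws : ∀ m {i a} o f → i < a → f + free (drop i o) < m → tails m a o f ≡ 0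
  tails-vanish-flaws m {i} {a} o f i<a f+free<m = count-allSeqs-none n m _ (λ cs len valid →
    <⇒≱ f+free<m (subst₂ (λ x y → x ≤ y + free (drop i o)) len (proj₁ (proj₂ (ValidTail-parts {a} {o} {f} {cs} valid)))
                   (flawsFrom-bound a o cs i<a (proj₁ (ValidTail-parts {a} {o} {f} {cs} valid)))))

  -- The invariant of the recursion: P = length xs + t is the last occupied space, the previous
  -- preference a satisfies a + h = P + 1 and a + e = l, and all r free spaces must be filled by the
  -- m cars to come (f + r = m).
  record Config (m e h a : ℕ) (xs : List Bool) (t r f : ℕ) : Set where
    field
      xs<a    : length xs < a
      a+e≡l   : a + e ≡ l
      a+h≡1+P : a + h ≡ suc (length xs + t)
      f+r≡m   : f + r ≡ m
      P+r≡n   : length xs + t + r ≡ n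

  ClosedForm : ℕ → Set
  ClosedForm m = ∀ e h {a xs t r f} → Config m e h a xs t r f → tails m a (lot xs t r) f + crossingPaths m h e ≡ allPaths m e

  module _ (l≤n : l ≤ n) {m e h a : ℕ} {xs : List Bool} {t r f : ℕ} (c : Config m e h a xs t r f) where
    open Config c

    a≤n : a ≤ n
    a≤n = ≤-trans (subst (a ≤_) a+e≡l (m≤m+n a e)) l≤n

    r≤m : r ≤ m
    r≤m = subst (r ≤_) f+r≡m (m≤n+m r f)

    1+n≡a+[h+r] : suc n ≡ a + (h + r)
    1+n≡a+[h+r] = begin
      suc n                    ≡⟨ cong suc P+r≡n ⟨
      suc (length xs + t) + r  ≡⟨ cong (_+ r) a+h≡1+P ⟨
      a + h + r                ≡⟨ +-assoc a h r ⟩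
      a + (h + r)              ∎
      where open ≡-Reasoning

    e<h+r : e < h + r
    e<h+r = +-cancelˡ-< a e (h + r) (subst (a + e <_) 1+n≡a+[h+r] (s≤s (subst (_≤ n) (sym a+e≡l) l≤n)))

    free-beyond : free (drop a (lot xs t r)) < h + r
    free-beyond = begin-strict
      free (drop a (lot xs t r))  ≤⟨ free-drop≤ a (lot xs t r) ⟩
      length (lot xs t r) ∸ a     ≡⟨ cong (_∸ a) (trans (length-lot xs t r) P+r≡n) ⟩
      n ∸ a                       <⟨ +-cancelˡ-< a (n ∸ a) (h + r) (subst₂ _<_ (sym (m+[n∸m]≡n a≤n)) 1+n≡a+[h+r] ≤-refl) ⟩
      h + r                       ∎
      where open ≤-Reasoning

    preference-in-reach : ∀ {a′} → a ≡ suc a′ → length xs ≤ a′ × a′ ≤ length xs + t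
    preference-in-reach refl = ≤-pred xs<a , ≤-pred (subst (a ≤_) a+h≡1+P (m≤m+n a h))

  tailsAfter-closed : l ≤ n → ∀ {m e h a xs t r f} → ClosedForm m → Config (suc m) e h a xs t r f →
    tailsAfter m a (lot xs t r) f + crossingPaths m (suc h) e ≡ allPaths m e
  tailsAfter-closed l≤n {m} {e} {h} {suc a} {xs} {t} {suc r} {f} IH c
    rewrite parkFrom-lot-suc xs t r (proj₁ (preference-in-reach l≤n c refl)) (proj₂ (preference-in-reach l≤n c refl)) =
    IH e (suc h) {suc a} {xs} {suc t} {r} {f} record
      { xs<a    = xs<a
      ; a+e≡l   = a+e≡l
      ; a+h≡1+P = trans (+-suc (suc a) h) (cong suc (trans a+h≡1+P (sym (+-suc (length xs) t))))
      ; f+r≡m   = suc-injective (trans (sym (+-suc f r)) f+r≡m)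
      ; P+r≡n   = trans (cong (_+ r) (+-suc (length xs) t)) (trans (sym (+-suc (length xs + t) r)) P+r≡n)
      }
    where open Config c
  tailsAfter-closed l≤n {m} {e} {h} {suc a} {xs} {t} {zero} {suc f} IH c
    rewrite parkFrom-lot-zero xs t (proj₁ (preference-in-reach l≤n c refl)) (proj₂ (preference-in-reach l≤n c refl)) =
    trans (cong (tails m (suc a) (lot xs t zero) f +_)
                (trans (crossingPaths-vanish m (m≤n⇒m≤1+n e≤h)) (sym (crossingPaths-vanish m e≤h))))
          (IH e h {suc a} {xs} {t} {zero} {f} record
            { xs<a    = xs<a
            ; a+e≡l   = a+e≡l
            ; a+h≡1+P = a+h≡1+P
            ; f+r≡m   = suc-injective f+r≡m
            ; P+r≡n   = P+r≡n
            })
    where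
    open Config c
    e≤h : e ≤ h
    e≤h = <⇒≤ (subst (e <_) (+-identityʳ h) (e<h+r l≤n c))
  tailsAfter-closed l≤n {r = zero} {f = zero} IH c with () ← Config.f+r≡m c

  tails-peel-config : l ≤ n → ∀ {m e h a xs t r f} → Config (suc m) e h a xs t r f →
    tails (suc m) a (lot xs t r) f ≡ tailsAfter m a (lot xs t r) f + tails (suc m) (suc a) (lot xs t r) f
  tails-peel-config l≤n {m} {xs = xs} {t} {r} {f} c =
    tails-peel m (lot xs t r) f (≤-trans (s≤s z≤n) (Config.xs<a c)) (a≤n l≤n c)

  closed-zero : ClosedForm 0
  closed-zero e h {a} {xs} {t} {r} {f} c with m+n≡0⇒m≡0 f (Config.f+r≡m c)
  ... | refl = trans (+-identityʳ _) (trans (tails-zero {a} (lot xs t r)) (leading-is-max e (Config.a+e≡l c)))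
    where
    leading-is-max : ∀ e → a + e ≡ l → (if a ≡ᵇ l then 1 else 0) ≡ allPaths 0 e
    leading-is-max zero    a+0≡l = if-≡ᵇ-yes (trans (sym (+-identityʳ a)) a+0≡l)
    leading-is-max (suc e) a+e≡l = if-≡ᵇ-no (λ a≡l → m+1+n≢m a (trans a+e≡l (sym a≡l)))

  tails-closed : l ≤ n → ∀ m → ClosedForm m
  tails-closed l≤n zero = closed-zero
  tails-closed l≤n (suc m) e zero {a} {xs} {t} {r} {f} c = begin
    tails (suc m) a o f + crossingPaths (suc m) 0 e
      ≡⟨ cong (_+ crossingPaths (suc m) 0 e) (tails-peel-config l≤n c) ⟩
    tailsAfter m a o f + tails (suc m) (suc a) o f + crossingPaths (suc m) 0 e
      ≡⟨ cong (λ y → tailsAfter m a o f + y + crossingPaths (suc m) 0 e) beyond-frontier ⟩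
    tailsAfter m a o f + 0 + crossingPaths (suc m) 0 e
      ≡⟨ cong (_+ crossingPaths (suc m) 0 e) (+-identityʳ _) ⟩
    tailsAfter m a o f + crossingPaths (suc m) 0 e
      ≡⟨ paths-step-frontier m e no-gap (tailsAfter-closed l≤n (tails-closed l≤n m) c) ⟩
    allPaths (suc m) e
      ∎
    where
    open ≡-Reasoning
    open Config c
    o = lot xs t r
    -- a next preference beyond a = P + 1 leaves space a empty for good
    beyond-frontier : tails (suc m) (suc a) o f ≡ 0
    beyond-frontier = tails-vanish-flaws (suc m) o f (n<1+n a) (subst (f + free (drop a o) <_) f+r≡m (+-monoʳ-< f (free-beyond l≤n c)))
    no-gap : m ≡ 0 → e ≡ 0
    no-gap refl = n<1⇒n≡0 (<-≤-trans (e<h+r l≤n c) (r≤m l≤n c))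
  tails-closed l≤n (suc m) zero (suc h) {a} {xs} {t} {r} {f} c = begin
    tails (suc m) a o f + crossingPaths (suc m) (suc h) 0
      ≡⟨ cong₂ _+_ (tails-peel-config l≤n c) (crossingPaths-vanish (suc m) {suc h} z≤n) ⟩
    tailsAfter m a o f + tails (suc m) (suc a) o f + 0
      ≡⟨ cong (λ y → tailsAfter m a o f + y + 0) (tails-vanish-max (suc m) o f l<1+a) ⟩
    tailsAfter m a o f + 0 + 0
      ≡⟨ trans (+-identityʳ _) (cong (tailsAfter m a o f +_) (sym (crossingPaths-vanish m z≤n))) ⟩
    tailsAfter m a o f + crossingPaths m (suc (suc h)) 0
      ≡⟨ tailsAfter-closed l≤n (tails-closed l≤n m) c ⟩
    allPaths m 0
      ≡⟨ allPaths-zero m ⟩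
    1
      ∎
    where
    open ≡-Reasoning
    open Config c
    o = lot xs t r
    l<1+a : l < suc a
    l<1+a = s≤s (≤-reflexive (trans (sym a+e≡l) (+-identityʳ a)))
  tails-closed l≤n (suc m) (suc e) (suc h) {a} {xs} {t} {r} {f} c = begin
    tails (suc m) a o f + crossingPaths (suc m) (suc h) (suc e)
      ≡⟨ cong (_+ crossingPaths (suc m) (suc h) (suc e)) (tails-peel-config l≤n c) ⟩
    tailsAfter m a o f + tails (suc m) (suc a) o f + crossingPaths (suc m) (suc h) (suc e)
      ≡⟨ paths-step m e h room (tailsAfter-closed l≤n (tails-closed l≤n m) c) (tails-closed l≤n (suc m) e h next) ⟩
    allPaths (suc m) (suc e)
      ∎
    where
    open ≡-Reasoning
    open Config c
    o = lot xs t r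
    next : Config (suc m) e h (suc a) xs t r f
    next = record
      { xs<a    = m<n⇒m<1+n xs<a
      ; a+e≡l   = trans (sym (+-suc a e)) a+e≡l
      ; a+h≡1+P = trans (sym (+-suc a h)) a+h≡1+P
      ; f+r≡m   = f+r≡m
      ; P+r≡n   = P+r≡n
      }
    room : m ≡ 0 → e ≤ h
    room refl = ≤-pred (≤-trans (≤-pred (e<h+r l≤n c))
                         (≤-trans (+-monoʳ-≤ h (r≤m l≤n c)) (≤-reflexive (+-comm h 1))))

selected-elsewhere : ∀ n k l {c} cs → c ≢ suc k → selected n k l (c ∷ cs) ≡ false
selected-elsewhere n k l {c} cs c≢1+k with c ≡ᵇ suc k | ≡ᵇ⇒≡ c (suc k)
... | true  | c≡1+k = ⊥-elim (c≢1+k (c≡1+k _))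
... | false | _     =
  trans (cong (isOrdered (c ∷ cs) ∧_) (∧-zeroʳ (flaws n (c ∷ cs) ≡ᵇ k))) (∧-zeroʳ (isOrdered (c ∷ cs)))

selected-leading : ∀ m k l cs → k < suc m →
  selected (suc m) k l (suc k ∷ cs) ≡ Tails.ValidTail (suc m) l (suc k) (lot (replicate k false) 1 (m ∸ k)) k cs
selected-leading m k l cs k<n rewrite Equivalence.to T-≡ (≡⇒≡ᵇ k k refl) | parkFrom-emptyLot k<n = refl

op≡tails : ∀ m k l → k < suc m → op (suc m) k l ≡ Tails.tails (suc m) l m (suc k) (lot (replicate k false) 1 (m ∸ k)) k
op≡tails m k l k<n = begin
  op n k l
    ≡⟨ length-filter≡count (selected n k l) (allSeqs n n) ⟩
  count (selected n k l) (allSeqs n (suc m))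
    ≡⟨ count-allSeqs-suc n m (selected n k l) ⟩
  sumRange (λ c → count (selected n k l ∘ (c ∷_)) (allSeqs n m)) 1 n
    ≡⟨ sumRange-only _ k<n (λ c c≢1+k →
         trans (count-cong (λ cs → selected-elsewhere n k l cs c≢1+k) (allSeqs n m)) (count-false (allSeqs n m))) ⟩
  count (selected n k l ∘ (suc k ∷_)) (allSeqs n m)
    ≡⟨ count-cong (λ cs → selected-leading m k l cs k<n) (allSeqs n m) ⟩
  Tails.tails n l m (suc k) (lot (replicate k false) 1 (m ∸ k)) k
    ∎
  where
  open ≡-Reasoning
  n = suc m

op-closed : ∀ k e d → op (suc (k + e + d)) k (suc k + e) + crossingPaths (k + e + d) 1 e ≡ allPaths (k + e + d) e
op-closed k e d =
  trans (cong (_+ crossingPaths m 1 e) (op≡tails m k l (s≤s k≤m))) (Tails.tails-closed n l (m≤m+n l d) m e 1 start)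
  where
  m = k + e + d
  n = suc m
  l = suc k + e
  k≤m : k ≤ m
  k≤m = ≤-trans (m≤m+n k e) (m≤m+n (k + e) d)
  start : Tails.Config n l m e 1 (suc k) (replicate k false) 1 (m ∸ k) k
  start = record
    { xs<a    = s≤s (≤-reflexive (length-replicate k))
    ; a+e≡l   = refl
    ; a+h≡1+P = cong (λ x → suc (x + 1)) (sym (length-replicate k))
    ; f+r≡m   = m+[n∸m]≡n k≤m
    ; P+r≡n   = trans (cong (λ x → x + 1 + (m ∸ k)) (length-replicate k))
                      (trans (cong (_+ (m ∸ k)) (+-comm k 1)) (cong suc (m+[n∸m]≡n k≤m)))
    }

op-formula : ∀ k e d →
  op (suc k + e + d) k (suc k + e) * (suc k + e + d + (suc k + e) ∸ suc k)
  ≡ (suc k + e + d ∸ (suc k + e) + suc k) * ((suc k + e + d + (suc k + e) ∸ suc k) C (suc k + e ∸ suc k))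
op-formula k e d = begin
  op n k l * (n + l ∸ suc k)                         ≡⟨ cong (op n k l *_) n+l∸1+k ⟩
  op n k l * (suc (e + j) + e)                       ≡⟨ ballot-formula j e (subst (λ m → op n k l + crossingPaths m 1 e ≡ allPaths m e) m≡e+j (op-closed k e d)) ⟩
  suc j * ((suc (e + j) + e) C e)                    ≡⟨ cong₂ (λ x y → x * (y C e)) n∸l+1+k n+l∸1+k ⟨
  (n ∸ l + suc k) * ((n + l ∸ suc k) C e)            ≡⟨ cong (λ x → (n ∸ l + suc k) * ((n + l ∸ suc k) C x)) (m+n∸m≡n (suc k) e) ⟨
  (n ∸ l + suc k) * ((n + l ∸ suc k) C (l ∸ suc k))  ∎
  where
  open ≡-Reasoning
  n = suc k + e + d
  l = suc k + e
  j = d + k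
  m≡e+j : k + e + d ≡ e + j
  m≡e+j = rearrange k e d
    where
    rearrange : ∀ k e d → k + e + d ≡ e + (d + k)
    rearrange = solve-∀
  n+l∸1+k : n + l ∸ suc k ≡ suc (e + j) + e
  n+l∸1+k = trans (cong (_∸ suc k) (rearrange k e d)) (m+n∸n≡m (suc (e + j) + e) (suc k))
    where
    rearrange : ∀ k e d → suc k + e + d + (suc k + e) ≡ suc (e + (d + k)) + e + suc k
    rearrange = solve-∀
  n∸l+1+k : n ∸ l + suc k ≡ suc j
  n∸l+1+k = trans (cong (_+ suc k) (m+n∸m≡n l d)) (+-suc d k)

mainTheorem7 : (n k l : ℕ) → suc k ≤ l → l ≤ n →
    op n k l * (n + l ∸ suc k) ≡ (n ∸ l + suc k) * ((n + l ∸ suc k) C (l ∸ suc k))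
mainTheorem7 n k l k<l l≤n with m≤n⇒∃[o]m+o≡n k<l | m≤n⇒∃[o]m+o≡n l≤n
... | e , refl | d , refl = op-formula k e d
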